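{- The rules $(ref)$: from $\mathcal{R},w\le w,\Gamma\Rightarrow\Delta$ infer $\mathcal{R},\Gamma\Rightarrow\Delta$, and $(tra)$: from $\mathcal{R},w\le u,u\le v,w\le v,\Gamma\Rightarrow\Delta$ infer $\mathcal{R},w\le u,u\le v,\Gamma\Rightarrow\Delta$, are eliminable in $\mathsf{IntQL}$ and in $\mathsf{IntQCL}$: any derivation using them can be algorithmically transformed into a derivation of the same end sequent without them.
   Context: Language: parameters $\underline{a},\dots$, bound variables $x,\dots$; $\phi::=p(\vec{\underline{a}})\mid\bot\mid\phi\wedge\phi\mid\phi\vee\phi\mid\phi\to\phi\mid\exists x\phi\mid\forall x\phi$. Labelled sequents $\mathcal{R},\Gamma\Rightarrow\Delta$: $\mathcal{R}$ a multiset of relational atoms $w\le u$ (possibly also domain atoms $\underline{a}\in D_w$, unused by the rules), $\Gamma,\Delta$ multisets of labelled formulas. $u$ reachable from $w$: $u=w$ or $\mathcal{R}$ contains $w\le v_1,\dots,v_n\le u$; connected: linked by a chain of atoms in either direction. $\underline{a}$ is $S4$-available ($S5$-available) for $w$ if some $v:\psi\in\Gamma\cup\Delta$ contains $\underline{a}$ with $w$ reachable from $v$ ($v,w$ connected). Eigenvariable: not in the conclusion. Rules of $\mathsf{IntXL}$, $\mathsf{X}\in\{\mathsf{Q},\mathsf{QC}\}$: $(id_*)$: $\mathcal{R},\Gamma,w:p(\vec{\underline{a}})\Rightarrow u:p(\vec{\underline{a}}),\Delta$, $u$ reachable from $w$; $(\bot_l)$: $\mathcal{R},\Gamma,w:\bot\Rightarrow\Delta$;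 $(\wedge_l),(\wedge_r),(\vee_l),(\vee_r)$ standard at one label; $(\to_r)$: $\mathcal{R},w\le u,\Gamma,u:\phi\Rightarrow u:\psi,\Delta$ / $\mathcal{R},\Gamma\Rightarrow w:\phi\to\psi,\Delta$, $u$ eigenvariable; $(Pr_\to)$: $\mathcal{R},w:\phi\to\psi,\Gamma\Rightarrow\Delta,u:\phi$ and $\mathcal{R},w:\phi\to\psi,u:\psi,\Gamma\Rightarrow\Delta$ / $\mathcal{R},w:\phi\to\psi,\Gamma\Rightarrow\Delta$, $u$ reachable from $w$; $(\exists_r)$: $\mathcal{R},\Gamma\Rightarrow\Delta,w:\phi(\underline{a}/x),w:\exists x\phi$ / $\mathcal{R},\Gamma\Rightarrow\Delta,w:\exists x\phi$, $\underline{a}$ $S4$- ($\mathsf{Q}$) resp. $S5$-available ($\mathsf{QC}$) for $w$ or eigenvariable; $(\forall_l)$: $\mathcal{R},w:\forall x\phi,v:\phi(\underline{a}/x),\Gamma\Rightarrow\Delta$ / $\mathcal{R},w:\forall x\phi,\Gamma\Rightarrow\Delta$, $\underline{a}$ $S4$- ($\mathsf{Q}$) resp. $S5$-available ($\mathsf{QC}$) for $v$ or eigenvariable, $v$ reachable from $w$; $(\forall_r)$: $\mathcal{R},w\le u,\Gamma\Rightarrow u:\phi(\underline{a}/x),\Delta$ / $\mathcal{R},\Gamma\Rightarrow w:\forall x\phi,\Delta$, $\underline{a},u$ eigenvariables; $(\exists_l)$: $\mathcal{R},\Gamma,w:\phi(\underline{a}/x)\Rightarrow\Delta$ / $\mathcal{R},\Gamma,w:\exists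 x\phi\Rightarrow\Delta$, $\underline{a}$ eigenvariable. $\mathsf{IntQL}$: $\mathsf{X}=\mathsf{Q}$; $\mathsf{IntQCL}$: $\mathsf{X}=\mathsf{QC}$. -}

module Defs where

open import Data.Nat using (ℕ; suc)
open import Data.Fin using (Fin; zero; suc)
open import Data.Bool using (Bool; true; false; T)
open import Data.List using (List; []; _∷_; _++_; map; concatMap)
open import Data.List.Membership.Propositional using (_∈_; _∉_)
open import Data.List.Relation.Binary.Permutation.Propositional using (_↭_)
open import Data.Product using (_×_; _,_; ∃-syntax)
open import Data.Sum using (_⊎_)

-- Syntax (well-scoped de Bruijn for bound variables; parameters are ℕ)

data Term (n : ℕ) : Set where
  par : ℕ → Term n
  var : Fin n → Term n

data Fm (n : ℕ) : Set where
  atom : ℕ → List (Term n) → Fm n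
  ⊥ᶠ   : Fm n
  _∧ᶠ_ : Fm n → Fm n → Fm n
  _∨ᶠ_ : Fm n → Fm n → Fm n
  _⇒ᶠ_ : Fm n → Fm n → Fm n
  ∃ᶠ   : Fm (suc n) → Fm n
  ∀ᶠ   : Fm (suc n) → Fm n

wkT : ∀ {n} → Term n → Term (suc n)
wkT (par a) = par a
wkT (var i) = var (suc i)

lift : ∀ {m n} → (Fin m → Term n) → Fin (suc m) → Term (suc n)
lift σ zero    = var zero
lift σ (suc i) = wkT (σ i)

substT : ∀ {m n} → (Fin m → Term n) → Term m → Term n
substT σ (par a) = par a
substT σ (var i) = σ i

substF : ∀ {m n} → (Fin m → Term n) → Fm m → Fm n
substF σ (atom p ts) = atom p (map (substT σ) ts)
substF σ ⊥ᶠ         = ⊥ᶠ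
substF σ (A ∧ᶠ B)   = substF σ A ∧ᶠ substF σ B
substF σ (A ∨ᶠ B)   = substF σ A ∨ᶠ substF σ B
substF σ (A ⇒ᶠ B)   = substF σ A ⇒ᶠ substF σ B
substF σ (∃ᶠ A)     = ∃ᶠ (substF (lift σ) A)
substF σ (∀ᶠ A)     = ∀ᶠ (substF (lift σ) A)

inst : Fm 1 → ℕ → Fm 0
inst φ a = substF (λ _ → par a) φ

paramsT : ∀ {n} → Term n → List ℕ
paramsT (par a) = a ∷ []
paramsT (var _) = []

paramsF : ∀ {n} → Fm n → List ℕ
paramsF (atom p ts) = concatMap paramsT ts
paramsF ⊥ᶠ         = []
paramsF (A ∧ᶠ B)   = paramsF A ++ paramsF B
paramsF (A ∨ᶠ B)   = paramsF A ++ paramsF B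
paramsF (A ⇒ᶠ B)   = paramsF A ++ paramsF B
paramsF (∃ᶠ A)     = paramsF A
paramsF (∀ᶠ A)     = paramsF A

LFm : Set
LFm = ℕ × Fm 0

data RAtom : Set where
  _≤ᴿ_ : ℕ → ℕ → RAtom
  _∈D_ : ℕ → ℕ → RAtom   -- (parameter a) ∈D (label w)

labelsR : List RAtom → List ℕ
labelsR []             = []
labelsR ((w ≤ᴿ u) ∷ R) = w ∷ u ∷ labelsR R
labelsR ((a ∈D w) ∷ R) = w ∷ labelsR R

paramsR : List RAtom → List ℕ
paramsR []             = []
paramsR ((w ≤ᴿ u) ∷ R) = paramsR R
paramsR ((a ∈D w) ∷ R) = a ∷ paramsR R

labelsL : List LFm → List ℕ
labelsL = map (λ p → Data.Product.proj₁ p)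
  where import Data.Product

paramsL : List LFm → List ℕ
paramsL = concatMap (λ p → paramsF (Data.Product.proj₂ p))
  where import Data.Product

FreshLabel : ℕ → List RAtom → List LFm → List LFm → Set
FreshLabel u R Γ Δ = u ∉ (labelsR R ++ labelsL Γ ++ labelsL Δ)

FreshParam : ℕ → List RAtom → List LFm → List LFm → Set
FreshParam a R Γ Δ = a ∉ (paramsR R ++ paramsL Γ ++ paramsL Δ)

data Reach (R : List RAtom) : ℕ → ℕ → Set where
  here : ∀ {w} → Reach R w w
  step : ∀ {w v u} → (w ≤ᴿ v) ∈ R → Reach R v u → Reach R w u

data Conn (R : List RAtom) : ℕ → ℕ → Set where
  here : ∀ {w} → Conn R w w
  fwd  : ∀ {w v u} → (w ≤ᴿ v) ∈ R → Conn R v u → Conn R w u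
  bwd  : ∀ {w v u} → (v ≤ᴿ w) ∈ R → Conn R v u → Conn R w u

-- The two calculi: IntQL (Q, S4-availability) and IntQCL (QC, S5-availability)
data Mode : Set where
  Q QC : Mode

Link : Mode → List RAtom → ℕ → ℕ → Set
Link Q  R v w = Reach R v w
Link QC R v w = Conn R v w

Available : Mode → ℕ → ℕ → List RAtom → List LFm → List LFm → Set
Available X a w R Γ Δ =
  ∃[ v ] ∃[ ψ ] ((v , ψ) ∈ (Γ ++ Δ) × a ∈ paramsF ψ × Link X R v w)

AvailOrFresh : Mode → ℕ → ℕ → List RAtom → List LFm → List LFm → Set
AvailOrFresh X a w R Γ Δ = Available X a w R Γ Δ ⊎ FreshParam a R Γ Δ

-- Derivations in IntXL; the flag s says whether (ref) and (tra) may be used.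
-- Multisets are represented by lists; the constructor `perm` makes
-- derivability invariant under reordering (multiset reading).

data Der (X : Mode) (s : Bool) : List RAtom → List LFm → List LFm → Set where
  perm : ∀ {R R′ Γ Γ′ Δ Δ′} → R ↭ R′ → Γ ↭ Γ′ → Δ ↭ Δ′ →
         Der X s R Γ Δ → Der X s R′ Γ′ Δ′
  idₐ  : ∀ {R Γ Δ w u p ts} → Reach R w u →
         Der X s R ((w , atom p ts) ∷ Γ) ((u , atom p ts) ∷ Δ)
  ⊥ₗ   : ∀ {R Γ Δ w} → Der X s R ((w , ⊥ᶠ) ∷ Γ) Δ
  ∧ₗ   : ∀ {R Γ Δ w A B} → Der X s R ((w , A) ∷ (w , B) ∷ Γ) Δ →
         Der X s R ((w , A ∧ᶠ B) ∷ Γ) Δ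
  ∧ᵣ   : ∀ {R Γ Δ w A B} → Der X s R Γ ((w , A) ∷ Δ) → Der X s R Γ ((w , B) ∷ Δ) →
         Der X s R Γ ((w , A ∧ᶠ B) ∷ Δ)
  ∨ₗ   : ∀ {R Γ Δ w A B} → Der X s R ((w , A) ∷ Γ) Δ → Der X s R ((w , B) ∷ Γ) Δ →
         Der X s R ((w , A ∨ᶠ B) ∷ Γ) Δ
  ∨ᵣ   : ∀ {R Γ Δ w A B} → Der X s R Γ ((w , A) ∷ (w , B) ∷ Δ) →
         Der X s R Γ ((w , A ∨ᶠ B) ∷ Δ)
  ⇒ᵣ   : ∀ {R Γ Δ w u A B} → FreshLabel u R Γ ((w , A ⇒ᶠ B) ∷ Δ) →
         Der X s ((w ≤ᴿ u) ∷ R) ((u , A) ∷ Γ) ((u , B) ∷ Δ) →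
         Der X s R Γ ((w , A ⇒ᶠ B) ∷ Δ)
  Pr⇒  : ∀ {R Γ Δ w u A B} → Reach R w u →
         Der X s R ((w , A ⇒ᶠ B) ∷ Γ) ((u , A) ∷ Δ) →
         Der X s R ((u , B) ∷ (w , A ⇒ᶠ B) ∷ Γ) Δ →
         Der X s R ((w , A ⇒ᶠ B) ∷ Γ) Δ
  ∃ᵣ   : ∀ {R Γ Δ w a φ} → AvailOrFresh X a w R Γ ((w , ∃ᶠ φ) ∷ Δ) →
         Der X s R Γ ((w , inst φ a) ∷ (w , ∃ᶠ φ) ∷ Δ) →
         Der X s R Γ ((w , ∃ᶠ φ) ∷ Δ)
  ∀ₗ   : ∀ {R Γ Δ w v a φ} → Reach R w v →
         AvailOrFresh X a v R ((w , ∀ᶠ φ) ∷ Γ) Δ →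
         Der X s R ((w , ∀ᶠ φ) ∷ (v , inst φ a) ∷ Γ) Δ →
         Der X s R ((w , ∀ᶠ φ) ∷ Γ) Δ
  ∀ᵣ   : ∀ {R Γ Δ w u a φ} → FreshParam a R Γ ((w , ∀ᶠ φ) ∷ Δ) →
         FreshLabel u R Γ ((w , ∀ᶠ φ) ∷ Δ) →
         Der X s ((w ≤ᴿ u) ∷ R) Γ ((u , inst φ a) ∷ Δ) →
         Der X s R Γ ((w , ∀ᶠ φ) ∷ Δ)
  ∃ₗ   : ∀ {R Γ Δ w a φ} → FreshParam a R ((w , ∃ᶠ φ) ∷ Γ) Δ →
         Der X s R ((w , inst φ a) ∷ Γ) Δ →
         Der X s R ((w , ∃ᶠ φ) ∷ Γ) Δ
  ref  : ∀ {R Γ Δ w} → T s → Der X s ((w ≤ᴿ w) ∷ R) Γ Δ → Der X s R Γ Δ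
  tra  : ∀ {R Γ Δ w u v} → T s →
         Der X s ((w ≤ᴿ u) ∷ (u ≤ᴿ v) ∷ (w ≤ᴿ v) ∷ R) Γ Δ →
         Der X s ((w ≤ᴿ u) ∷ (u ≤ᴿ v) ∷ R) Γ Δ

DerRT : Mode → List RAtom → List LFm → List LFm → Set
DerRT X = Der X true

DerInt : Mode → List RAtom → List LFm → List LFm → Set
DerInt X = Der X false

{-# OPTIONS --safe #-}
-- A derivation over a relational context R′ can be replayed over any R in
-- whose reflexive–transitive closure every atom of R′ holds: the rules consult
-- the relational atoms only through reachability (or connectedness), which
-- is preserved, and eigenvariable conditions survive as long as R′ mentions
-- every label and parameter of R.  The atoms added by (ref) and (tra) are
-- such closure facts, so these two rules can simply be dropped.
module Submission where

open import Defs
open import Data.Nat using (ℕ)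
open import Data.Bool using (false)
open import Data.Product using (_,_)
open import Data.Sum using (inj₁; inj₂)
open import Data.List using (List; []; _∷_; concatMap)
open import Data.List.Membership.Propositional using (_∈_)
open import Data.List.Relation.Unary.Any using (here; there)
open import Data.List.Relation.Binary.Subset.Propositional using (_⊆_)
open import Data.List.Relation.Binary.Subset.Propositional.Properties
  using (⊆-reflexive-↭; concatMap⁺; ++⁺ˡ)
open import Data.List.Relation.Binary.Permutation.Propositional using (_↭_; ↭-refl; ↭-sym)
open import Data.List.Relation.Binary.Permutation.Propositional.Properties using (shift; ∈-resp-↭)
open import Relation.Binary.PropositionalEquality using (_≡_; refl; sym; cong; subst₂)

labelsᴬ : RAtom → List ℕ
labelsᴬ (w ≤ᴿ u) = w ∷ u ∷ []
labelsᴬ (a ∈D w) = w ∷ []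

paramsᴬ : RAtom → List ℕ
paramsᴬ (w ≤ᴿ u) = []
paramsᴬ (a ∈D w) = a ∷ []

labelsR≡concatMap : ∀ R → labelsR R ≡ concatMap labelsᴬ R
labelsR≡concatMap []             = refl
labelsR≡concatMap ((w ≤ᴿ u) ∷ R) = cong (λ L → w ∷ u ∷ L) (labelsR≡concatMap R)
labelsR≡concatMap ((a ∈D w) ∷ R) = cong (w ∷_) (labelsR≡concatMap R)

paramsR≡concatMap : ∀ R → paramsR R ≡ concatMap paramsᴬ R
paramsR≡concatMap []             = refl
paramsR≡concatMap ((w ≤ᴿ u) ∷ R) = paramsR≡concatMap R
paramsR≡concatMap ((a ∈D w) ∷ R) = cong (a ∷_) (paramsR≡concatMap R)

labelsR-↭ : ∀ {R R′} → R ↭ R′ → labelsR R ⊆ labelsR R′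
labelsR-↭ {R} {R′} p = subst₂ _⊆_ (sym (labelsR≡concatMap R)) (sym (labelsR≡concatMap R′))
                                  (concatMap⁺ labelsᴬ (⊆-reflexive-↭ p))

paramsR-↭ : ∀ {R R′} → R ↭ R′ → paramsR R ⊆ paramsR R′
paramsR-↭ {R} {R′} p = subst₂ _⊆_ (sym (paramsR≡concatMap R)) (sym (paramsR≡concatMap R′))
                                  (concatMap⁺ paramsᴬ (⊆-reflexive-↭ p))

Reach-trans : ∀ {R w v u} → Reach R w v → Reach R v u → Reach R w u
Reach-trans here       q = q
Reach-trans (step x p) q = step x (Reach-trans p q)

Reach-∷ : ∀ {R r w u} → Reach R w u → Reach (r ∷ R) w u
Reach-∷ here       = here
Reach-∷ (step x p) = step (there x) (Reach-∷ p)

Conn-trans : ∀ {R w v u} → Conn R w v → Conn R v u → Conn R w u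
Conn-trans here      q = q
Conn-trans (fwd x p) q = fwd x (Conn-trans p q)
Conn-trans (bwd x p) q = bwd x (Conn-trans p q)

Reach⇒Conn : ∀ {R w u} → Reach R w u → Conn R w u
Reach⇒Conn here       = here
Reach⇒Conn (step x p) = fwd x (Reach⇒Conn p)

Reach⇒Conn⁻¹ : ∀ {R w u} → Reach R w u → Conn R u w
Reach⇒Conn⁻¹ here       = here
Reach⇒Conn⁻¹ (step x p) = Conn-trans (Reach⇒Conn⁻¹ p) (bwd x here)

-- The last two fields make eigenvariable conditions over R′ imply those over R.
record _⊑_ (R′ R : List RAtom) : Set where
  field
    ≤⇒Reach : ∀ {w u} → (w ≤ᴿ u) ∈ R′ → Reach R w u
    labels⊇ : labelsR R ⊆ labelsR R′
    params⊇ : paramsR R ⊆ paramsR R′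
open _⊑_

⊑-refl : ∀ {R} → R ⊑ R
⊑-refl = record { ≤⇒Reach = λ x → step x here ; labels⊇ = λ m → m ; params⊇ = λ m → m }

⊑-respˡ-↭ : ∀ {R₁ R₂ R} → R₁ ↭ R₂ → R₁ ⊑ R → R₂ ⊑ R
⊑-respˡ-↭ p s = record
  { ≤⇒Reach = λ x → ≤⇒Reach s (∈-resp-↭ (↭-sym p) x)
  ; labels⊇ = λ m → labelsR-↭ p (labels⊇ s m)
  ; params⊇ = λ m → paramsR-↭ p (params⊇ s m)
  }

⊑-extend : ∀ {R′ R w u} → Reach R w u → R′ ⊑ R → ((w ≤ᴿ u) ∷ R′) ⊑ R
⊑-extend w↝u s = record
  { ≤⇒Reach = λ { (here refl) → w↝u ; (there x) → ≤⇒Reach s x }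
  ; labels⊇ = λ m → there (there (labels⊇ s m))
  ; params⊇ = params⊇ s
  }

∷-mono-⊑ : ∀ {R′ R w u} → R′ ⊑ R → ((w ≤ᴿ u) ∷ R′) ⊑ ((w ≤ᴿ u) ∷ R)
∷-mono-⊑ s = record
  { ≤⇒Reach = λ { (here refl) → step (here refl) here ; (there x) → Reach-∷ (≤⇒Reach s x) }
  ; labels⊇ = λ { (here p) → here p ; (there (here p)) → there (here p)
                ; (there (there m)) → there (there (labels⊇ s m)) }
  ; params⊇ = params⊇ s
  }

⊑-Reach : ∀ {R′ R w u} → R′ ⊑ R → Reach R′ w u → Reach R w u
⊑-Reach s here       = here
⊑-Reach s (step x p) = Reach-trans (≤⇒Reach s x) (⊑-Reach s p)

⊑-Conn : ∀ {R′ R w u} → R′ ⊑ R → Conn R′ w u → Conn R w u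
⊑-Conn s here      = here
⊑-Conn s (fwd x p) = Conn-trans (Reach⇒Conn (≤⇒Reach s x)) (⊑-Conn s p)
⊑-Conn s (bwd x p) = Conn-trans (Reach⇒Conn⁻¹ (≤⇒Reach s x)) (⊑-Conn s p)

⊑-Link : ∀ X {R′ R w u} → R′ ⊑ R → Link X R′ w u → Link X R w u
⊑-Link Q  = ⊑-Reach
⊑-Link QC = ⊑-Conn

⊑-FreshLabel : ∀ {R′ R u} Γ Δ → R′ ⊑ R → FreshLabel u R′ Γ Δ → FreshLabel u R Γ Δ
⊑-FreshLabel Γ Δ s fresh m = fresh (++⁺ˡ _ (labels⊇ s) m)

⊑-FreshParam : ∀ {R′ R a} Γ Δ → R′ ⊑ R → FreshParam a R′ Γ Δ → FreshParam a R Γ Δ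
⊑-FreshParam Γ Δ s fresh m = fresh (++⁺ˡ _ (params⊇ s) m)

⊑-AvailOrFresh : ∀ {X R′ R a w} Γ Δ → R′ ⊑ R →
                 AvailOrFresh X a w R′ Γ Δ → AvailOrFresh X a w R Γ Δ
⊑-AvailOrFresh {X} Γ Δ s (inj₁ (v , ψ , v:ψ , a∈ψ , link)) = inj₁ (v , ψ , v:ψ , a∈ψ , ⊑-Link X s link)
⊑-AvailOrFresh     Γ Δ s (inj₂ fresh)                      = inj₂ (⊑-FreshParam Γ Δ s fresh)

replay : ∀ {X b R′ R Γ Δ} → Der X b R′ Γ Δ → R′ ⊑ R → Der X false R Γ Δ
replay (perm p q r d) s = perm ↭-refl q r (replay d (⊑-respˡ-↭ (↭-sym p) s))
replay (idₐ w↝u)      s = idₐ (⊑-Reach s w↝u)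
replay ⊥ₗ             s = ⊥ₗ
replay (∧ₗ d)         s = ∧ₗ (replay d s)
replay (∧ᵣ d e)       s = ∧ᵣ (replay d s) (replay e s)
replay (∨ₗ d e)       s = ∨ₗ (replay d s) (replay e s)
replay (∨ᵣ d)         s = ∨ᵣ (replay d s)
replay (Pr⇒ w↝u d e)  s = Pr⇒ (⊑-Reach s w↝u) (replay d s) (replay e s)
replay (⇒ᵣ {Γ = Γ} {Δ} {w} {A = A} {B} u# d) s =
  ⇒ᵣ (⊑-FreshLabel Γ ((w , A ⇒ᶠ B) ∷ Δ) s u#) (replay d (∷-mono-⊑ s))
replay (∃ᵣ {Γ = Γ} {Δ} {w} {φ = φ} a? d) s =
  ∃ᵣ (⊑-AvailOrFresh Γ ((w , ∃ᶠ φ) ∷ Δ) s a?) (replay d s)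
replay (∀ₗ {Γ = Γ} {Δ} {w} {φ = φ} w↝v a? d) s =
  ∀ₗ (⊑-Reach s w↝v) (⊑-AvailOrFresh ((w , ∀ᶠ φ) ∷ Γ) Δ s a?) (replay d s)
replay (∀ᵣ {Γ = Γ} {Δ} {w} {φ = φ} a# u# d) s =
  ∀ᵣ (⊑-FreshParam Γ Δ′ s a#) (⊑-FreshLabel Γ Δ′ s u#) (replay d (∷-mono-⊑ s))
  where Δ′ = (w , ∀ᶠ φ) ∷ Δ
replay (∃ₗ {Γ = Γ} {Δ} {w} {φ = φ} a# d) s =
  ∃ₗ (⊑-FreshParam ((w , ∃ᶠ φ) ∷ Γ) Δ s a#) (replay d s)
replay (ref _ d)      s = replay d (⊑-extend here s)
replay (tra {R = R₀} {w = w} {u} {v} _ d) s =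
  replay d (⊑-respˡ-↭ (↭-sym (shift (w ≤ᴿ v) ((w ≤ᴿ u) ∷ (u ≤ᴿ v) ∷ []) R₀)) (⊑-extend w↝v s))
  where
  w↝v : Reach _ w v
  w↝v = Reach-trans (≤⇒Reach s (here refl)) (≤⇒Reach s (there (here refl)))

mainTheorem11 : (X : Mode) (R : List RAtom) (Γ Δ : List LFm) →
    DerRT X R Γ Δ → DerInt X R Γ Δ
mainTheorem11 X R Γ Δ d = replay d ⊑-refl
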